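{- Let $m,n$ be positive integers and let $g\in G(m,1,n)$. Then $g$ is fully commutative in $G(m,1,n)$ (with respect to the generating set $\{s_0,s_1,\ldots,s_{n-1}\}$) if and only if $\pi(g)$ is fully commutative in $G(2,1,n)=B_n$ (with respect to the generating set $\{s_0,s_1,\ldots,s_{n-1}\}$ of $B_n$).
   Context: Let $\omega=\exp(2\pi i/m)$. $G(m,1,n)$ is the group of $n\times n$ monomial matrices (exactly one nonzero entry in each row and column) whose nonzero entries are $m$-th roots of unity. For a permutation $w$ of $\{1,\ldots,n\}$ and integers $a_1,\ldots,a_n$, $[w;(a_1,\ldots,a_n)]$ denotes the monomial matrix whose unique nonzero entry in column $i$ is $\omega^{a_i}$, located in row $w(i)$. The generators are $s_0=[\mathrm{id};(1,0,\ldots,0)]$ and $s_j=[(j\ j+1);(0,\ldots,0)]$ for $1\le j\le n-1$. For $m=2$ this is the hyperoctahedral group $B_n$ of signed permutation matrices with its Coxeter generators. A reduced expression of $g$ is a word in the letters $s_0,\ldots,s_{n-1}$ of minimal length whose product is $g$. An element $g$ is fully commutative if every reduced expression of $g$ can be obtained from any other by a sequence of interchanges of adjacent letters $s_is_j\to s_js_i$ with $|i-j|\ge 2$ (commuting generators). An entry of a matrix in $G(m,1,n)$ is called nontrivial if it is neither $0$ nor $1$. The map $\pi:G(m,1,n)\to G(2,1,n)$ sends $g$ to the matrix obtained from $g$ by replacing every nontrivial entry with $-1$. -}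

module Defs where

open import Data.Nat using (ℕ; zero; suc; _+_; _≤_; NonZero)
open import Data.Nat.DivMod using (_mod_)
open import Data.Fin using (Fin; zero; suc; toℕ; inject₁; fromℕ<)
open import Data.Fin.Permutation using (Permutation; _⟨$⟩ʳ_; _∘ₚ_; transpose)
  renaming (id to idₚ)
open import Data.List using (List; []; _∷_; _++_; length)
open import Data.Product using (_×_)
open import Data.Sum using (_⊎_)
open import Relation.Binary.PropositionalEquality using (_≡_)
open import Relation.Binary.Construct.Closure.ReflexiveTransitive using (Star)

-- An element [w ; (a_1,…,a_n)] of G(m,1,n): the monomial matrix whose
-- unique nonzero entry in column i is ω^(a_i), located in row w(i).
-- Positions are 0-indexed (Fin n); exponents are residues mod m (Fin m).
record Elem (m n : ℕ) : Set where
  constructor [_⸴_]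
  field
    perm : Permutation n n
    exps : Fin n → Fin m
open Elem public

_≈G_ : ∀ {m n} → Elem m n → Elem m n → Set
g ≈G h = ∀ i → (perm g ⟨$⟩ʳ i ≡ perm h ⟨$⟩ʳ i) × (exps g i ≡ exps h i)

_+ₘ_ : ∀ {m} .{{_ : NonZero m}} → Fin m → Fin m → Fin m
_+ₘ_ {m} a b = (toℕ a + toℕ b) mod m

-- matrix product: [w;a]·[v;b] sends e_i ↦ ω^(b_i + a_(v i)) e_(w(v i))
_·_ : ∀ {m n} .{{_ : NonZero m}} → Elem m n → Elem m n → Elem m n
g · h = [ perm h ∘ₚ perm g ⸴ (λ i → exps h i +ₘ exps g (perm h ⟨$⟩ʳ i)) ]

e : ∀ {m n} .{{_ : NonZero m}} → Elem m n
e = [ idₚ ⸴ (λ _ → zero′) ]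
  where
  zero′ : ∀ {m} .{{_ : NonZero m}} → Fin m
  zero′ {m} = 0 mod m

-- generators s_0, …, s_(n-1), indexed by Fin n.
-- s_0 = [id ; (1,0,…,0)];  s_j (j ≥ 1) = [(j j+1) ; (0,…,0)], which in
-- 0-indexed positions swaps positions j-1 and j.
gen : ∀ {m n} .{{_ : NonZero m}} → Fin n → Elem m n
gen {m} {suc n} zero = [ idₚ ⸴ exp0 ]
  where
  exp0 : Fin (suc n) → Fin m
  exp0 zero    = 1 mod m
  exp0 (suc _) = 0 mod m
gen {m} {suc n} (suc k) = [ transpose (inject₁ k) (suc k) ⸴ (λ _ → 0 mod m) ]

eval : ∀ {m n} .{{_ : NonZero m}} → List (Fin n) → Elem m n
eval []      = e
eval (x ∷ w) = gen x · eval w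

Reduced : ∀ {m n} .{{_ : NonZero m}} → Elem m n → List (Fin n) → Set
Reduced g w = (eval w ≈G g) × (∀ w′ → eval w′ ≈G g → length w ≤ length w′)

Far : ∀ {n} → Fin n → Fin n → Set
Far i j = (toℕ i + 2 ≤ toℕ j) ⊎ (toℕ j + 2 ≤ toℕ i)

data CommStep {n : ℕ} : List (Fin n) → List (Fin n) → Set where
  swap : ∀ u v i j → Far i j → CommStep (u ++ i ∷ j ∷ v) (u ++ j ∷ i ∷ v)

FullyCommutative : ∀ {m n} .{{_ : NonZero m}} → Elem m n → Set
FullyCommutative g =
  ∀ w w′ → Reduced g w → Reduced g w′ → Star CommStep w w′

-- π : G(m,1,n) → G(2,1,n): replace every nontrivial entry (ω^a with
-- a ≢ 0 mod m) by -1 = ω₂^1; trivial entries 1 = ω^0 stay 1.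
πB : ∀ {m n} → Elem m n → Elem 2 n
πB {m} {n} g = [ perm g ⸴ (λ i → sgn (exps g i)) ]
  where
  sgn : Fin m → Fin 2
  sgn zero    = zero
  sgn (suc _) = suc zero

-- Record a matrix of G(m,1,n) by its rows: for each row, the column of its
-- nonzero entry and the exponent of that entry.  An explicit function ℓ of this
-- data (the exponents plus a contribution from each pair of rows) goes down by
-- exactly one under s_x⁻¹ for every left descent x and never under the other
-- generators, so ℓ is the length and reduced words are descents followed by
-- reduced words of s_x⁻¹ g.  Hence g is fully commutative iff any two distinct
-- descents are far apart and every s_x⁻¹ g with x a descent is fully
-- commutative.  Descents only depend on the columns and on which entries are
-- nontrivial, so g and π(g) have the same descents, and π(s_x⁻¹ g) is either
-- s_x⁻¹ π(g) or π(g) itself; induction on ℓ transfers full commutativity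
-- between g and π(g).

module Submission where

open import Defs
open import Data.Nat as ℕ using (ℕ; zero; suc; _+_; _≤_; _<_; z≤n; s≤s; s≤s⁻¹; NonZero; _%_)
open import Data.Nat.Properties
  using ( +-comm; +-suc; +-identityʳ; +-monoˡ-≤; ≤-trans; ≤-reflexive; ≤-antisym; <⇒≤; ≤∧≢⇒<
        ; m≤n+m; n≤1+n; 1+n≢n; 1+n≢0; 0≢1+n; 1+n≰n; m+1+n≰m; suc-injective
        ; +-0-commutativeMonoid; module ≤-Reasoning)
open import Data.Nat.DivMod using (_mod_; m<n⇒m%n≡m; n%n≡0; m%n≤m)
open import Data.Nat.Solver using (module +-*-Solver)
open import Data.Fin as Fin using (Fin; zero; suc; toℕ; inject₁; fromℕ)
open import Data.Fin.Properties using (any?; toℕ-injective; toℕ-inject₁; toℕ<n; toℕ-fromℕ<; toℕ-fromℕ)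
open import Data.Fin.Permutation using (Permutation; permutation; _⟨$⟩ʳ_; _⟨$⟩ˡ_; inverseˡ; inverseʳ)
import Data.Fin.Permutation.Components as PC
open import Algebra.Properties.CommutativeMonoid.Sum +-0-commutativeMonoid
  using (sum; sum-permute; sum-cong-≗; sum-replicate-zero)
open import Data.Vec.Functional using (tail)
import Data.Bool as Bool
open import Data.Bool.Properties using (¬-not)
open Bool using (Bool; true; false)
import Data.Product as Product
open Product using (Σ; _×_; _,_; proj₁; proj₂)
open import Data.List using (List; []; _∷_; _++_; length)
open import Data.Empty using (⊥-elim)
import Data.Sum as Sum
open Sum using (_⊎_; inj₁; inj₂; [_,_]′)
open import Function using (_∘_)
open import Function.Bundles using (_⇔_; mk⇔; Equivalence)
open import Function.Properties.Equivalence using (⇔-setoid) renaming (sym to ⇔-sym)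
open import Level using (0ℓ)
import Relation.Binary.Reasoning.Setoid as SetoidReasoning
open import Relation.Nullary using (¬_; Dec; yes; no)
open import Relation.Binary.PropositionalEquality
open import Relation.Binary.Construct.Closure.ReflexiveTransitive using (Star; ε; _◅_; _◅◅_; gmap)

≗-sym : ∀ {A B : Set} {f g : A → B} → f ≗ g → g ≗ f
≗-sym f≗g x = sym (f≗g x)

≗-trans : ∀ {A B : Set} {f g h : A → B} → f ≗ g → g ≗ h → f ≗ h
≗-trans f≗g g≗h x = trans (f≗g x) (g≗h x)

nontrivial : ∀ {m} → Fin m → Bool
nontrivial zero    = false
nontrivial (suc _) = true

sign : ∀ {m} → Fin m → Fin 2
sign zero    = zero
sign (suc _) = suc zero

nontrivial-sign : ∀ {m} (a : Fin m) → nontrivial (sign a) ≡ nontrivial a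
nontrivial-sign zero    = refl
nontrivial-sign (suc _) = refl

trivial⇒toℕ≡0 : ∀ {m} (a : Fin m) → nontrivial a ≡ false → toℕ a ≡ 0
trivial⇒toℕ≡0 zero _ = refl

sucₘ : ∀ {m} .{{_ : NonZero m}} → Fin m → Fin m
sucₘ {m} a = a +ₘ (1 mod m)

predₘ : ∀ {m} → Fin m → Fin m
predₘ {suc m} zero    = fromℕ m
predₘ {suc m} (suc a) = inject₁ a

toℕ-sucₘ : ∀ {m} (a : Fin (suc (suc m))) → toℕ (sucₘ a) ≡ suc (toℕ a) % suc (suc m)
toℕ-sucₘ {m} a = trans (toℕ-fromℕ< _) (cong (_% suc (suc m)) (+-comm (toℕ a) 1))

toℕ-sucₘ-≤ : ∀ {m} .{{_ : NonZero m}} (a : Fin m) → toℕ (sucₘ a) ≤ suc (toℕ a)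
toℕ-sucₘ-≤ {suc zero}    zero = z≤n
toℕ-sucₘ-≤ {suc (suc m)} a    = ≤-trans (≤-reflexive (toℕ-sucₘ a)) (m%n≤m _ _)

toℕ-predₘ-nontrivial : ∀ {m} (a : Fin m) → nontrivial a ≡ true → toℕ a ≡ suc (toℕ (predₘ a))
toℕ-predₘ-nontrivial {suc m} (suc a) _ = cong suc (sym (toℕ-inject₁ a))

sucₘ-predₘ : ∀ {m} .{{_ : NonZero m}} (a : Fin m) → sucₘ (predₘ a) ≡ a
sucₘ-predₘ {suc zero}    zero    = refl
sucₘ-predₘ {suc (suc m)} zero    = toℕ-injective (begin
  toℕ (sucₘ (fromℕ (suc m)))  ≡⟨ toℕ-sucₘ (fromℕ (suc m)) ⟩
  suc (toℕ (fromℕ (suc m))) % suc (suc m) ≡⟨ cong (λ c → suc c % suc (suc m)) (toℕ-fromℕ (suc m)) ⟩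
  suc (suc m) % suc (suc m)   ≡⟨ n%n≡0 (suc (suc m)) ⟩
  0                           ∎)
  where open ≡-Reasoning
sucₘ-predₘ {suc (suc m)} (suc a) = toℕ-injective (begin
  toℕ (sucₘ (inject₁ a))            ≡⟨ toℕ-sucₘ (inject₁ a) ⟩
  suc (toℕ (inject₁ a)) % suc (suc m) ≡⟨ cong (λ c → suc c % suc (suc m)) (toℕ-inject₁ a) ⟩
  suc (toℕ a) % suc (suc m)         ≡⟨ m<n⇒m%n≡m (s≤s (toℕ<n a)) ⟩
  suc (toℕ a)                       ∎)
  where open ≡-Reasoning

predₘ-sucₘ : ∀ {m} .{{_ : NonZero m}} (a : Fin m) → predₘ (sucₘ a) ≡ a
predₘ-sucₘ {suc zero}    zero = refl
predₘ-sucₘ {suc (suc m)} a with toℕ a ℕ.≟ suc m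
... | yes a≡last = toℕ-injective (begin
  toℕ (predₘ (sucₘ a)) ≡⟨ cong (toℕ ∘ predₘ) sucₘa≡0 ⟩
  toℕ (fromℕ (suc m))  ≡⟨ toℕ-fromℕ (suc m) ⟩
  suc m                ≡⟨ sym a≡last ⟩
  toℕ a                ∎)
  where
  open ≡-Reasoning
  sucₘa≡0 : sucₘ a ≡ zero
  sucₘa≡0 = toℕ-injective (trans (toℕ-sucₘ a)
    (trans (cong (λ c → suc c % suc (suc m)) a≡last) (n%n≡0 (suc (suc m)))))
... | no a≢last = toℕ-injective (predₘ-of-suc (sucₘ a) (trans (toℕ-sucₘ a) (m<n⇒m%n≡m a+1<m)))
  where
  a+1<m : suc (toℕ a) < suc (suc m)
  a+1<m = s≤s (≤∧≢⇒< (s≤s⁻¹ (toℕ<n a)) a≢last)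
  predₘ-of-suc : ∀ (b : Fin (suc (suc m))) → toℕ b ≡ suc (toℕ a) → toℕ (predₘ b) ≡ toℕ a
  predₘ-of-suc (suc b) e = trans (toℕ-inject₁ b) (suc-injective e)

sign-predₘ : ∀ {m} (a : Fin m) → nontrivial a ≡ true →
  sign (predₘ a) ≡ predₘ (sign a) ⊎ sign (predₘ a) ≡ sign a
sign-predₘ (suc zero)    _ = inj₁ refl
sign-predₘ (suc (suc _)) _ = inj₂ refl

+ₘ-zero : ∀ {m} .{{_ : NonZero m}} (a : Fin m) → a +ₘ (0 mod m) ≡ a
+ₘ-zero {suc m} a = toℕ-injective (trans (toℕ-fromℕ< _)
  (trans (cong (_% suc m) (+-identityʳ (toℕ a))) (m<n⇒m%n≡m (toℕ<n a))))

adjSwap : ∀ {n} → Fin n → Fin (suc n) → Fin (suc n)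
adjSwap zero    zero          = suc zero
adjSwap zero    (suc zero)    = zero
adjSwap zero    (suc (suc i)) = suc (suc i)
adjSwap (suc p) zero          = zero
adjSwap (suc p) (suc i)       = suc (adjSwap p i)

adjSwap-involutive : ∀ {n} (p : Fin n) i → adjSwap p (adjSwap p i) ≡ i
adjSwap-involutive zero    zero          = refl
adjSwap-involutive zero    (suc zero)    = refl
adjSwap-involutive zero    (suc (suc i)) = refl
adjSwap-involutive (suc p) zero          = refl
adjSwap-involutive (suc p) (suc i)       = cong suc (adjSwap-involutive p i)

adjSwap-injective : ∀ {n} (p : Fin n) i j → adjSwap p i ≡ adjSwap p j → i ≡ j
adjSwap-injective p i j e =
  trans (sym (adjSwap-involutive p i)) (trans (cong (adjSwap p) e) (adjSwap-involutive p j))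

adjSwapₚ : ∀ {n} → Fin n → Permutation (suc n) (suc n)
adjSwapₚ p = permutation (adjSwap p) (adjSwap p) (adjSwap-involutive p) (adjSwap-involutive p)

adjSwap-inject₁ : ∀ {n} (p : Fin n) → adjSwap p (inject₁ p) ≡ suc p
adjSwap-inject₁ zero    = refl
adjSwap-inject₁ (suc p) = cong suc (adjSwap-inject₁ p)

adjSwap-suc : ∀ {n} (p : Fin n) → adjSwap p (suc p) ≡ inject₁ p
adjSwap-suc zero    = refl
adjSwap-suc (suc p) = cong suc (adjSwap-suc p)

adjSwap-fix : ∀ {n} (p : Fin n) i → i ≢ inject₁ p → i ≢ suc p → adjSwap p i ≡ i
adjSwap-fix zero    zero          i≢p  _     = ⊥-elim (i≢p refl)
adjSwap-fix zero    (suc zero)    _    i≢p+1 = ⊥-elim (i≢p+1 refl)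
adjSwap-fix zero    (suc (suc i)) _    _     = refl
adjSwap-fix (suc p) zero          _    _     = refl
adjSwap-fix (suc p) (suc i)       i≢p  i≢p+1 =
  cong suc (adjSwap-fix p i (i≢p ∘ cong suc) (i≢p+1 ∘ cong suc))

adjSwap-comm : ∀ {n} (p q : Fin n) → toℕ p + 2 ≤ toℕ q →
  adjSwap p ∘ adjSwap q ≗ adjSwap q ∘ adjSwap p
adjSwap-comm zero    (suc (suc q)) _ zero          = refl
adjSwap-comm zero    (suc (suc q)) _ (suc zero)    = refl
adjSwap-comm zero    (suc (suc q)) _ (suc (suc i)) = refl
adjSwap-comm (suc p) (suc q)       _ zero          = refl
adjSwap-comm (suc p) (suc q)       p≪q (suc i)     = cong suc (adjSwap-comm p q (s≤s⁻¹ p≪q) i)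
adjSwap-comm zero    (suc zero)    (s≤s ())

far-irrefl : ∀ {n} {i : Fin n} → ¬ Far i i
far-irrefl {i = i} (inj₁ i≪i) = m+1+n≰m (toℕ i) i≪i
far-irrefl {i = i} (inj₂ i≪i) = m+1+n≰m (toℕ i) i≪i

far-sym : ∀ {n} {i j : Fin n} → Far i j → Far j i
far-sym = Sum.swap

far-pred : ∀ {n} {p q : Fin n} → Far (Fin.suc p) (suc q) → Far p q
far-pred = Sum.map s≤s⁻¹ s≤s⁻¹

data FarPair : ∀ {n} → Fin n → Fin n → Set where
  zero-left  : ∀ {n} (q : Fin n) → FarPair zero (suc (suc q))
  zero-right : ∀ {n} (p : Fin n) → FarPair (suc (suc p)) zero
  both-suc   : ∀ {n} {p q : Fin n} → Far p q → FarPair (suc p) (suc q)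

farPair : ∀ {n} {x y : Fin n} → Far x y → FarPair x y
farPair {x = zero}          {suc (suc q)} _   = zero-left q
farPair {x = suc (suc p)}   {zero}        _   = zero-right p
farPair {x = suc p}         {suc q}       far = both-suc (far-pred far)
farPair {x = zero}          {zero}        (inj₁ ())
farPair {x = zero}          {zero}        (inj₂ ())
farPair {x = zero}          {suc zero}    (inj₁ (s≤s ()))
farPair {x = zero}          {suc zero}    (inj₂ ())
farPair {x = suc zero}      {zero}        (inj₁ ())
farPair {x = suc zero}      {zero}        (inj₂ (s≤s ()))

adjSwap-far-fixes : ∀ {n} (p q : Fin n) → Far p q →
  adjSwap q (inject₁ p) ≡ inject₁ p × adjSwap q (suc p) ≡ suc p
adjSwap-far-fixes p q far with farPair far
... | zero-left _  = refl , refl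
... | zero-right _ = refl , refl
... | both-suc {p = p} {q = q} far′ = Product.map (cong suc) (cong suc) (adjSwap-far-fixes p q far′)

-- The length function

Cell : ℕ → ℕ → Set
Cell n m = Fin n × Fin m

column : ∀ {n m} → Cell n m → Fin n
column = proj₁

exponent : ∀ {n m} → Cell n m → Fin m
exponent = proj₂

Rows : ℕ → ℕ → ℕ → Set
Rows k n m = Fin k → Cell n m

ColumnInjective : ∀ {k n m} → Rows k n m → Set
ColumnInjective R = ∀ i j → column (R i) ≡ column (R j) → i ≡ j

less : ℕ → ℕ → ℕ
less _       zero    = 0
less zero    (suc _) = 1
less (suc a) (suc b) = less a b

less-≥ : ∀ {a b} → b ≤ a → less a b ≡ 0
less-≥ {b = zero}  _         = refl
less-≥ {suc a} {suc b} (s≤s b≤a) = less-≥ b≤a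

less-trichotomy : ∀ a b → a ≢ b → (less a b ≡ 1 × less b a ≡ 0) ⊎ (less a b ≡ 0 × less b a ≡ 1)
less-trichotomy zero    zero    a≢b = ⊥-elim (a≢b refl)
less-trichotomy zero    (suc b) _   = inj₁ (refl , refl)
less-trichotomy (suc a) zero    _   = inj₂ (refl , refl)
less-trichotomy (suc a) (suc b) a≢b = less-trichotomy a b (a≢b ∘ cong suc)

less≡1⇒< : ∀ a b → less a b ≡ 1 → a < b
less≡1⇒< zero    (suc b) _ = s≤s z≤n
less≡1⇒< (suc a) (suc b) e = s≤s (less≡1⇒< a b e)

-- The contribution to ℓ of an upper row in column c over a lower row in column
-- c′; the entry of the upper row plays no role.
pairLength : ℕ → ℕ → Bool → ℕ
pairLength c c′ false = less c′ c
pairLength c c′ true  = suc (less c c′)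

pairℓ : ∀ {n m} → Cell n m → Cell n m → ℕ
pairℓ y z = pairLength (toℕ (column y)) (toℕ (column z)) (nontrivial (exponent z))

mutual
  -- shown to be the length of the element in reducedᴿ⇒length≡ℓ
  ℓ : ∀ {k n m} → Rows k n m → ℕ
  ℓ {zero}  R = 0
  ℓ {suc k} R = toℕ (exponent (R zero)) + ℓ-rest R

  -- everything but the exponent of the top row, the only thing s₀ changes
  ℓ-rest : ∀ {k n m} → Rows (suc k) n m → ℕ
  ℓ-rest R = sum (λ j → pairℓ (R zero) (R (suc j))) + ℓ (tail R)

Inverted : ∀ {n m} → Cell n m → Cell n m → Set
Inverted y z = pairℓ y z ≡ suc (pairℓ z y)

pairLength-trichotomy : ∀ c f c′ f′ → c ≢ c′ →
  pairLength c c′ f′ ≡ suc (pairLength c′ c f) ⊎ pairLength c′ c f ≡ suc (pairLength c c′ f′)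
pairLength-trichotomy c false c′ true  _ = inj₁ refl
pairLength-trichotomy c true  c′ false _ = inj₂ refl
pairLength-trichotomy c false c′ false c≢c′ with less-trichotomy c c′ c≢c′
... | inj₁ (p , q) rewrite p | q = inj₂ refl
... | inj₂ (p , q) rewrite p | q = inj₁ refl
pairLength-trichotomy c true  c′ true  c≢c′ with less-trichotomy c c′ c≢c′
... | inj₁ (p , q) rewrite p | q = inj₁ refl
... | inj₂ (p , q) rewrite p | q = inj₂ refl

inverted-or-inverted : ∀ {n m} (y z : Cell n m) → column y ≢ column z → Inverted y z ⊎ Inverted z y
inverted-or-inverted y z y≢z = pairLength-trichotomy _ (nontrivial (exponent y)) _ (nontrivial (exponent z))
  (y≢z ∘ toℕ-injective)

ℓ-cong : ∀ {k n m} {R S : Rows k n m} → R ≗ S → ℓ R ≡ ℓ S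
ℓ-cong {zero}  _   = refl
ℓ-cong {suc k} {R = R} {S} R≗S rewrite R≗S zero =
  cong₂ (λ s t → toℕ (exponent (S zero)) + (s + t))
    (sum-cong-≗ (λ j → cong (pairℓ (S zero)) (R≗S (suc j))))
    (ℓ-cong (R≗S ∘ suc))

open +-*-Solver using (solve; _:=_; con; _:+_)

ℓ-swap : ∀ {k n m} (p : Fin k) (R : Rows (suc k) n m) → Inverted (R (inject₁ p)) (R (suc p)) →
  ℓ R ≡ suc (ℓ (R ∘ adjSwap p))
ℓ-swap {suc k} zero R inv rewrite inv =
  solve 6 (λ a₀ a₁ d S₀ S₁ T → a₀ :+ (((con 1 :+ d) :+ S₀) :+ (a₁ :+ (S₁ :+ T)))
                            := con 1 :+ (a₁ :+ ((d :+ S₁) :+ (a₀ :+ (S₀ :+ T)))))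
        refl (toℕ (exponent (R zero))) (toℕ (exponent (R (suc zero))))
        (pairℓ (R (suc zero)) (R zero))
        (sum (λ j → pairℓ (R zero) (R (suc (suc j)))))
        (sum (λ j → pairℓ (R (suc zero)) (R (suc (suc j)))))
        (ℓ (λ j → R (suc (suc j))))
ℓ-swap {suc k} (suc p) R inv = begin
  a₀ + (sum (λ j → pairℓ (R zero) (R (suc j))) + ℓ (tail R))
    ≡⟨ cong₂ (λ s t → a₀ + (s + t))
         (sum-permute (λ j → pairℓ (R zero) (R (suc j))) (adjSwapₚ p))
         (ℓ-swap p (tail R) inv) ⟩
  a₀ + (sum (λ j → pairℓ (R zero) (R (suc (adjSwap p j)))) + suc (ℓ (tail R ∘ adjSwap p)))
    ≡⟨ cong (a₀ +_) (+-suc _ _) ⟩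
  a₀ + suc (ℓ-rest (R ∘ adjSwap (suc p)))
    ≡⟨ +-suc a₀ _ ⟩
  suc (ℓ (R ∘ adjSwap (suc p)))
    ∎
  where
  open ≡-Reasoning
  a₀ = toℕ (exponent (R zero))

ℓ-swap-uninverted : ∀ {k n m} (p : Fin k) (R : Rows (suc k) n m) → Inverted (R (suc p)) (R (inject₁ p)) →
  ℓ (R ∘ adjSwap p) ≡ suc (ℓ R)
ℓ-swap-uninverted p R inv = trans
  (ℓ-swap p (R ∘ adjSwap p)
    (subst₂ (λ i j → Inverted (R i) (R j)) (sym (adjSwap-inject₁ p)) (sym (adjSwap-suc p)) inv))
  (cong suc (ℓ-cong (cong R ∘ adjSwap-involutive p)))

sum-zero : ∀ {k} (f : Fin k → ℕ) → (∀ i → f i ≡ 0) → sum f ≡ 0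
sum-zero {k} f f≗0 = trans (sum-cong-≗ f≗0) (sum-replicate-zero k)

ℓ-sorted : ∀ {k n m} (R : Rows k n m) → (∀ i → nontrivial (exponent (R i)) ≡ false) →
  (∀ {i j} → i Fin.< j → column (R i) Fin.< column (R j)) → ℓ R ≡ 0
ℓ-sorted {zero}  R trivial increasing = refl
ℓ-sorted {suc k} R trivial increasing = cong₂ _+_
  (trivial⇒toℕ≡0 _ (trivial zero))
  (cong₂ _+_ (sum-zero _ pair≡0) (ℓ-sorted (tail R) (trivial ∘ suc) (increasing ∘ s≤s)))
  where
  pair≡0 : ∀ j → pairℓ (R zero) (R (suc j)) ≡ 0
  pair≡0 j rewrite trivial (suc j) = less-≥ (<⇒≤ (increasing {zero} {suc j} (s≤s z≤n)))

-- The rows of s_x · g in terms of the rows R of g, where f is what s₀ does to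
-- the exponent of the top row.
act : ∀ {k n m} → (Fin m → Fin m) → Fin k → Rows k n m → Rows k n m
act {suc k} f zero    R zero    = column (R zero) , f (exponent (R zero))
act {suc k} f zero    R (suc i) = R (suc i)
act {suc k} f (suc p) R i       = R (adjSwap p i)

s· : ∀ {k n m} .{{_ : NonZero m}} → Fin k → Rows k n m → Rows k n m
s· = act sucₘ

s⁻¹· : ∀ {k n m} → Fin k → Rows k n m → Rows k n m
s⁻¹· = act predₘ

act-cong : ∀ {k n m} f (x : Fin k) {R S : Rows k n m} → R ≗ S → act f x R ≗ act f x S
act-cong {suc k} f zero    R≗S zero    rewrite R≗S zero = refl
act-cong {suc k} f zero    R≗S (suc i) = R≗S (suc i)
act-cong {suc k} f (suc p) R≗S i       = R≗S (adjSwap p i)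

act-inverse : ∀ {k n m} {f g : Fin m → Fin m} → (∀ a → f (g a) ≡ a) →
  ∀ (x : Fin k) (R : Rows k n m) → act f x (act g x R) ≗ R
act-inverse {suc k} f∘g≡id zero    R zero    = cong (column (R zero) ,_) (f∘g≡id (exponent (R zero)))
act-inverse {suc k} f∘g≡id zero    R (suc i) = refl
act-inverse {suc k} f∘g≡id (suc p) R i       = cong R (adjSwap-involutive p i)

act-columnInjective : ∀ {k n m} f (x : Fin k) {R : Rows k n m} → ColumnInjective R → ColumnInjective (act f x R)
act-columnInjective {suc k} f zero {R} inj i j e =
  inj i j (trans (sym (column-act₀ i)) (trans e (column-act₀ j)))
  where
  column-act₀ : ∀ i → column (act f zero R i) ≡ column (R i)
  column-act₀ zero    = refl
  column-act₀ (suc i) = refl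
act-columnInjective {suc k} f (suc p) inj i j e = adjSwap-injective p i j (inj _ _ e)

adjacent-columns-distinct : ∀ {k n m} (R : Rows (suc k) n m) → ColumnInjective R →
  ∀ p → column (R (inject₁ p)) ≢ column (R (suc p))
adjacent-columns-distinct R inj p e = 1+n≢n (sym (trans (sym (toℕ-inject₁ p)) (cong toℕ (inj _ _ e))))

act-comm : ∀ {k n m} (f : Fin m → Fin m) (x y : Fin k) (R : Rows k n m) → Far x y →
  act f x (act f y R) ≗ act f y (act f x R)
act-comm f x y R far with farPair far
... | zero-left _  = λ { zero → refl ; (suc i) → refl }
... | zero-right _ = λ { zero → refl ; (suc i) → refl }
... | both-suc {p = p} {q = q} (inj₁ p≪q) = cong R ∘ ≗-sym (adjSwap-comm p q p≪q)
... | both-suc {p = p} {q = q} (inj₂ q≪p) = cong R ∘ adjSwap-comm q p q≪p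

Descent : ∀ {k n m} → Fin k → Rows k n m → Set
Descent {suc k} zero    R = nontrivial (exponent (R zero)) ≡ true
Descent {suc k} (suc p) R = Inverted (R (inject₁ p)) (R (suc p))

descent? : ∀ {k n m} (x : Fin k) (R : Rows k n m) → Dec (Descent x R)
descent? {suc k} zero    R = nontrivial (exponent (R zero)) Bool.≟ true
descent? {suc k} (suc p) R = pairℓ (R (inject₁ p)) (R (suc p)) ℕ.≟ suc (pairℓ (R (suc p)) (R (inject₁ p)))

descent-act-far : ∀ {k n m} (f : Fin m → Fin m) (x y : Fin k) (R : Rows k n m) → Far x y →
  Descent x R → Descent x (act f y R)
descent-act-far f x y R far d with farPair far
... | zero-left _  = d
... | zero-right _ = d
... | both-suc {p = p} {q = q} far′ with adjSwap-far-fixes p q far′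
...   | fixes-inject₁ , fixes-suc rewrite fixes-inject₁ | fixes-suc = d

ℓ-descent : ∀ {k n m} (x : Fin k) (R : Rows k n m) → Descent x R → ℓ R ≡ suc (ℓ (s⁻¹· x R))
ℓ-descent {suc k} zero    R d = cong (_+ ℓ-rest R) (toℕ-predₘ-nontrivial (exponent (R zero)) d)
ℓ-descent {suc k} (suc p) R d = ℓ-swap p R d

descent-or-ℓ-≤ : ∀ {k n m} (x : Fin k) (R : Rows k n m) → ColumnInjective R →
  Descent x R ⊎ ℓ R ≤ ℓ (s⁻¹· x R)
descent-or-ℓ-≤ {suc k} zero R _ with nontrivial (exponent (R zero)) in trivial
... | true  = inj₁ refl
... | false = inj₂ (≤-trans (≤-reflexive (cong (_+ ℓ-rest R) (trivial⇒toℕ≡0 _ trivial)))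
                            (m≤n+m (ℓ-rest R) (toℕ (predₘ (exponent (R zero))))))
descent-or-ℓ-≤ {suc k} (suc p) R inj 
  with inverted-or-inverted (R (inject₁ p)) (R (suc p)) (adjacent-columns-distinct R inj p)
... | inj₁ inv = inj₁ inv
... | inj₂ inv = inj₂ (≤-trans (n≤1+n _) (≤-reflexive (sym (ℓ-swap-uninverted p R inv))))

ℓ-s·-≤ : ∀ {k n m} .{{_ : NonZero m}} (x : Fin k) (R : Rows k n m) → ColumnInjective R →
  ℓ (s· x R) ≤ suc (ℓ R)
ℓ-s·-≤ {suc k} zero    R _   = +-monoˡ-≤ (ℓ-rest R) (toℕ-sucₘ-≤ (exponent (R zero)))
ℓ-s·-≤ {suc k} (suc p) R inj 
  with inverted-or-inverted (R (inject₁ p)) (R (suc p)) (adjacent-columns-distinct R inj p)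
... | inj₁ inv = ≤-trans (n≤1+n _) (≤-trans (≤-reflexive (sym (ℓ-swap p R inv))) (n≤1+n _))
... | inj₂ inv = ≤-reflexive (ℓ-swap-uninverted p R inv)

identityRows : ∀ {n m} .{{_ : NonZero m}} → Rows n n m
identityRows {m = m} r = r , 0 mod m

ℓ-identity : ∀ {n m} .{{_ : NonZero m}} → ℓ {n} (identityRows {n} {m}) ≡ 0
ℓ-identity {n} {suc m} = ℓ-sorted {n} identityRows (λ _ → refl) (λ i<j → i<j)

trivial-over-nontrivial-inverted : ∀ {n m} (y z : Cell n m) →
  nontrivial (exponent y) ≡ false → nontrivial (exponent z) ≡ true → Inverted y z
trivial-over-nontrivial-inverted y z y-trivial z-nontrivial rewrite y-trivial | z-nontrivial = refl

uninverted-trivial⇒< : ∀ {n m} (y z : Cell n m) →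
  nontrivial (exponent y) ≡ false → nontrivial (exponent z) ≡ false →
  column y ≢ column z → ¬ Inverted y z → toℕ (column y) < toℕ (column z)
uninverted-trivial⇒< y z y-trivial z-trivial y≢z ¬inv rewrite y-trivial | z-trivial
  with less-trichotomy (toℕ (column y)) (toℕ (column z)) (y≢z ∘ toℕ-injective)
... | inj₁ (p , _)     = less≡1⇒< _ _ p
... | inj₂ (p , q) rewrite p | q = ⊥-elim (¬inv refl)

descent-free⇒trivial : ∀ {k n m} (R : Rows k n m) → (∀ x → ¬ Descent x R) →
  ∀ i → nontrivial (exponent (R i)) ≡ false
descent-free⇒trivial R no-descent zero = ¬-not (no-descent zero)
descent-free⇒trivial {suc k} R no-descent (suc i) = descent-free⇒trivial (tail R) no-descent′ i
  where
  no-descent′ : ∀ x → ¬ Descent x (tail R)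
  no-descent′ zero    d = no-descent (suc zero)
    (trivial-over-nontrivial-inverted _ _ (descent-free⇒trivial R no-descent zero) d)
  no-descent′ (suc p) = no-descent (suc (suc p))

increasing-squeezed : ∀ {k} b (f : Fin (suc k) → ℕ) → (∀ p → f (inject₁ p) < f (suc p)) →
  (∀ i → f i < b + suc k) → b ≤ f zero → ∀ i → f i ≡ b + toℕ i
increasing-squeezed {zero} b f _ bounded b≤f₀ zero =
  ≤-antisym (s≤s⁻¹ (subst (f zero <_) (trans (+-comm b 1) (cong suc (sym (+-identityʳ b)))) (bounded zero)))
            (subst (_≤ f zero) (sym (+-identityʳ b)) b≤f₀)
increasing-squeezed {suc k} b f increasing bounded b≤f₀ = values
  where
  tail-values : ∀ j → f (suc j) ≡ suc b + toℕ j
  tail-values = increasing-squeezed (suc b) (f ∘ suc) (increasing ∘ suc)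
    (λ j → subst (f (suc j) <_) (+-suc b (suc k)) (bounded (suc j)))
    (≤-trans (s≤s b≤f₀) (increasing zero))
  values : ∀ i → f i ≡ b + toℕ i
  values zero    = ≤-antisym (s≤s⁻¹ (subst (f zero <_) (tail-values zero) (increasing zero)))
                             (subst (_≤ f zero) (sym (+-identityʳ b)) b≤f₀)
  values (suc j) = trans (tail-values j) (sym (+-suc b (toℕ j)))

descent-free⇒identity : ∀ {n m} .{{_ : NonZero m}} (R : Rows n n m) → ColumnInjective R →
  (∀ x → ¬ Descent x R) → R ≗ identityRows
descent-free⇒identity {zero} R _ _ ()
descent-free⇒identity {suc n} {suc m} R inj no-descent i =
  cong₂ _,_ (toℕ-injective (columns i)) (toℕ-injective (trivial⇒toℕ≡0 _ (trivial i)))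
  where
  trivial = descent-free⇒trivial R no-descent
  columns : ∀ i → toℕ (column (R i)) ≡ toℕ i
  columns = increasing-squeezed 0 (toℕ ∘ column ∘ R)
    (λ p → uninverted-trivial⇒< _ _ (trivial _) (trivial _)
             (adjacent-columns-distinct R inj p) (no-descent (suc p)))
    (λ i → toℕ<n (column (R i))) z≤n

evalᴿ : ∀ {n m} .{{_ : NonZero m}} → List (Fin n) → Rows n n m
evalᴿ []      = identityRows
evalᴿ (x ∷ w) = s· x (evalᴿ w)

evalᴿ-columnInjective : ∀ {n m} .{{_ : NonZero m}} (w : List (Fin n)) → ColumnInjective (evalᴿ {n} {m} w)
evalᴿ-columnInjective []      i j e = e
evalᴿ-columnInjective (x ∷ w) = act-columnInjective sucₘ x (evalᴿ-columnInjective w)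

ℓ-evalᴿ-≤ : ∀ {n m} .{{_ : NonZero m}} (w : List (Fin n)) → ℓ (evalᴿ {n} {m} w) ≤ length w
ℓ-evalᴿ-≤ {n} {m} []      = ≤-reflexive (ℓ-identity {n} {m})
ℓ-evalᴿ-≤ (x ∷ w) =
  ≤-trans (ℓ-s·-≤ x (evalᴿ w) (evalᴿ-columnInjective w)) (s≤s (ℓ-evalᴿ-≤ w))

word-of-length-ℓ : ∀ {n m} .{{_ : NonZero m}} N (R : Rows n n m) → ColumnInjective R → ℓ R ≡ N →
  Σ (List (Fin n)) λ w → evalᴿ w ≗ R × length w ≡ N
word-of-length-ℓ N R inj ℓR≡N with any? (λ x → descent? x R)
word-of-length-ℓ zero R inj ℓR≡0 | yes (x , d) = ⊥-elim (1+n≢0 (trans (sym (ℓ-descent x R d)) ℓR≡0))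
word-of-length-ℓ (suc N) R inj ℓR≡N | yes (x , d) with word-of-length-ℓ N (s⁻¹· x R)
    (act-columnInjective predₘ x inj) (suc-injective (trans (sym (ℓ-descent x R d)) ℓR≡N))
... | w , evalw≗ , length≡ =
  x ∷ w , ≗-trans (act-cong sucₘ x evalw≗) (act-inverse sucₘ-predₘ x R) , cong suc length≡
word-of-length-ℓ {n} N R inj ℓR≡N | no no-descent =
  [] , ≗-sym R≗id , trans (sym (trans (ℓ-cong R≗id) (ℓ-identity {n}))) ℓR≡N
  where R≗id = descent-free⇒identity R inj (λ x d → no-descent (x , d))

record Reducedᴿ {n m} .{{_ : NonZero m}} (R : Rows n n m) (w : List (Fin n)) : Set where
  constructor reducedᴿ
  field
    evaluates : evalᴿ w ≗ R
    minimal   : ∀ w′ → evalᴿ w′ ≗ R → length w ≤ length w′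
open Reducedᴿ

FullyCommutativeᴿ : ∀ {n m} .{{_ : NonZero m}} → Rows n n m → Set
FullyCommutativeᴿ R = ∀ w w′ → Reducedᴿ R w → Reducedᴿ R w′ → Star CommStep w w′

module _ {n m : ℕ} .{{_ : NonZero m}} where

  reducedᴿ⇒length≡ℓ : ∀ {R : Rows n n m} {w} → ColumnInjective R → Reducedᴿ R w → length w ≡ ℓ R
  reducedᴿ⇒length≡ℓ {R} {w} inj (reducedᴿ evalw≗R minimal) with word-of-length-ℓ (ℓ R) R inj refl
  ... | w₀ , evalw₀≗R , length≡ℓ = ≤-antisym
    (subst (length w ≤_) length≡ℓ (minimal w₀ evalw₀≗R))
    (subst (_≤ length w) (ℓ-cong evalw≗R) (ℓ-evalᴿ-≤ w))

  reducedᴿ-intro : ∀ {R : Rows n n m} {w} → evalᴿ w ≗ R → length w ≡ ℓ R → Reducedᴿ R w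
  reducedᴿ-intro {w = w} evalw≗R length≡ℓ =
    reducedᴿ evalw≗R λ w′ evalw′≗R →
      subst (_≤ length w′) (trans (ℓ-cong evalw′≗R) (sym length≡ℓ)) (ℓ-evalᴿ-≤ w′)

  reducedᴿ-exists : ∀ (R : Rows n n m) → ColumnInjective R → Σ (List (Fin n)) (Reducedᴿ R)
  reducedᴿ-exists R inj with word-of-length-ℓ (ℓ R) R inj refl
  ... | w , evalw≗R , length≡ℓ = w , reducedᴿ-intro evalw≗R length≡ℓ

  reducedᴿ-cong : ∀ {R S : Rows n n m} {w} → R ≗ S → Reducedᴿ R w → Reducedᴿ S w
  reducedᴿ-cong R≗S (reducedᴿ evalw≗R minimal) =
    reducedᴿ (≗-trans evalw≗R R≗S) λ w′ evalw′≗S → minimal w′ (≗-trans evalw′≗S (≗-sym R≗S))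

  fullyCommutativeᴿ-cong : ∀ {R S : Rows n n m} → R ≗ S → FullyCommutativeᴿ R → FullyCommutativeᴿ S
  fullyCommutativeᴿ-cong R≗S fc w w′ red red′ =
    fc w w′ (reducedᴿ-cong (≗-sym R≗S) red) (reducedᴿ-cong (≗-sym R≗S) red′)

  reducedᴿ-uncons : ∀ {R : Rows n n m} {x u} → ColumnInjective R → Reducedᴿ R (x ∷ u) →
    Descent x R × Reducedᴿ (s⁻¹· x R) u
  reducedᴿ-uncons {R} {x} {u} inj red = descent , reducedᴿ-intro evalu≗ length-u
    where
    evalu≗ : evalᴿ u ≗ s⁻¹· x R
    evalu≗ = ≗-trans (≗-sym (act-inverse predₘ-sucₘ x (evalᴿ u))) (act-cong predₘ x (evaluates red))
    length-xu : suc (length u) ≡ ℓ R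
    length-xu = reducedᴿ⇒length≡ℓ inj red
    descent : Descent x R
    descent with descent-or-ℓ-≤ x R inj
    ... | inj₁ d   = d
    ... | inj₂ ℓ≤ = ⊥-elim (1+n≰n (begin
      suc (length u)   ≡⟨ length-xu ⟩
      ℓ R              ≤⟨ ℓ≤ ⟩
      ℓ (s⁻¹· x R)     ≡⟨ ℓ-cong (≗-sym evalu≗) ⟩
      ℓ (evalᴿ u)      ≤⟨ ℓ-evalᴿ-≤ u ⟩
      length u         ∎))
      where open ≤-Reasoning
    length-u : length u ≡ ℓ (s⁻¹· x R)
    length-u = suc-injective (trans length-xu (ℓ-descent x R descent))

  reducedᴿ-cons : ∀ {R : Rows n n m} {x u} → ColumnInjective R → Descent x R →
    Reducedᴿ (s⁻¹· x R) u → Reducedᴿ R (x ∷ u)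
  reducedᴿ-cons {R} {x} inj d red = reducedᴿ-intro
    (≗-trans (act-cong sucₘ x (evaluates red)) (act-inverse sucₘ-predₘ x R))
    (trans (cong suc (reducedᴿ⇒length≡ℓ (act-columnInjective predₘ x inj) red)) (sym (ℓ-descent x R d)))

-- Commutation classes of words

data CommutesToFront {n} (x : Fin n) : List (Fin n) → Set where
  here  : ∀ w → CommutesToFront x (x ∷ w)
  there : ∀ {y w} → Far y x → CommutesToFront x w → CommutesToFront x (y ∷ w)

commutesToFront-step : ∀ {n} (x : Fin n) {w w′} → CommStep w w′ →
  CommutesToFront x w → CommutesToFront x w′
commutesToFront-step x (swap []      v i j far) (here _)                  = there (far-sym far) (here v)
commutesToFront-step x (swap []      v i j far) (there _ (here _))        = here (i ∷ v)
commutesToFront-step x (swap []      v i j far) (there i≁x (there j≁x c)) = there j≁x (there i≁x c)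
commutesToFront-step x (swap (y ∷ u) v i j far) (here _)                  = here _
commutesToFront-step x (swap (y ∷ u) v i j far) (there y≁x c)             =
  there y≁x (commutesToFront-step x (swap u v i j far) c)

commutesToFront-star : ∀ {n} (x : Fin n) {w w′} → Star CommStep w w′ →
  CommutesToFront x w → CommutesToFront x w′
commutesToFront-star x ε          c = c
commutesToFront-star x (step ◅ s) c = commutesToFront-star x s (commutesToFront-step x step c)

commutesToFront-head : ∀ {n} {x y : Fin n} {w} → CommutesToFront x (y ∷ w) → x ≢ y → Far y x
commutesToFront-head (here _)      x≢x = ⊥-elim (x≢x refl)
commutesToFront-head (there y≁x _) _   = y≁x

commStep-cons : ∀ {n} (y : Fin n) {w w′} → CommStep w w′ → CommStep (y ∷ w) (y ∷ w′)
commStep-cons y (swap u v i j far) = swap (y ∷ u) v i j far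

star-cons : ∀ {n} (y : Fin n) {w w′} → Star CommStep w w′ → Star CommStep (y ∷ w) (y ∷ w′)
star-cons y = gmap (y ∷_) (commStep-cons y)

deleteFirst : ∀ {n} → Fin n → List (Fin n) → List (Fin n)
deleteFirst x []      = []
deleteFirst x (y ∷ w) with y Fin.≟ x
... | yes _ = w
... | no  _ = y ∷ deleteFirst x w

deleteFirst-head : ∀ {n} (x : Fin n) w → deleteFirst x (x ∷ w) ≡ w
deleteFirst-head x w with x Fin.≟ x
... | yes _   = refl
... | no  x≢x = ⊥-elim (x≢x refl)

deleteFirst-other : ∀ {n} (x y : Fin n) w → y ≢ x → deleteFirst x (y ∷ w) ≡ y ∷ deleteFirst x w
deleteFirst-other x y w y≢x with y Fin.≟ x
... | yes y≡x = ⊥-elim (y≢x y≡x)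
... | no  _   = refl

deleteFirst-swap : ∀ {n} (x : Fin n) u v i j → Far i j →
  Star CommStep (deleteFirst x (u ++ i ∷ j ∷ v)) (deleteFirst x (u ++ j ∷ i ∷ v))
deleteFirst-swap x [] v i j far with i Fin.≟ x | j Fin.≟ x
... | yes refl | yes refl = ⊥-elim (far-irrefl far)
... | yes refl | no  _    rewrite deleteFirst-head x v = ε
... | no  _    | yes refl rewrite deleteFirst-head x v = ε
... | no  i≢x  | no  j≢x
  rewrite deleteFirst-other x j v j≢x | deleteFirst-other x i v i≢x = swap [] (deleteFirst x v) i j far ◅ ε
deleteFirst-swap x (y ∷ u) v i j far with y Fin.≟ x
... | yes _ = swap u v i j far ◅ ε
... | no  _ = star-cons y (deleteFirst-swap x u v i j far)

deleteFirst-star : ∀ {n} (x : Fin n) {w w′} → Star CommStep w w′ →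
  Star CommStep (deleteFirst x w) (deleteFirst x w′)
deleteFirst-star x ε          = ε
deleteFirst-star x (swap u v i j far ◅ s) = deleteFirst-swap x u v i j far ◅◅ deleteFirst-star x s

-- Full commutativity through descents

DescentsFar : ∀ {k n m} → Rows k n m → Set
DescentsFar R = ∀ x y → Descent x R → Descent y R → x ≢ y → Far x y

module _ {n m : ℕ} .{{_ : NonZero m}} where

  fullyCommutativeᴿ⇒descentsFar : ∀ {R : Rows n n m} → ColumnInjective R → FullyCommutativeᴿ R →
    DescentsFar R
  fullyCommutativeᴿ⇒descentsFar {R} inj fc x y dx dy x≢y
    with reducedᴿ-exists (s⁻¹· x R) (act-columnInjective predₘ x inj)
       | reducedᴿ-exists (s⁻¹· y R) (act-columnInjective predₘ y inj)
  ... | u , red-u | u′ , red-u′ =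
    far-sym (commutesToFront-head (commutesToFront-star x x∷u~y∷u′ (here u)) x≢y)
    where
    x∷u~y∷u′ = fc (x ∷ u) (y ∷ u′) (reducedᴿ-cons inj dx red-u) (reducedᴿ-cons inj dy red-u′)

  fullyCommutativeᴿ-s⁻¹· : ∀ {R : Rows n n m} → ColumnInjective R → FullyCommutativeᴿ R →
    ∀ x → Descent x R → FullyCommutativeᴿ (s⁻¹· x R)
  fullyCommutativeᴿ-s⁻¹· inj fc x dx u u′ red red′ =
    subst₂ (Star CommStep) (deleteFirst-head x u) (deleteFirst-head x u′)
      (deleteFirst-star x (fc (x ∷ u) (x ∷ u′) (reducedᴿ-cons inj dx red) (reducedᴿ-cons inj dx red′)))

  -- Two reduced words starting with different descents x, y are joined through
  -- x ∷ y ∷ w and y ∷ x ∷ w, for w reduced for s_y⁻¹ s_x⁻¹ R.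
  fullyCommutativeᴿ-intro : ∀ {R : Rows n n m} → ColumnInjective R → DescentsFar R →
    (∀ x → Descent x R → FullyCommutativeᴿ (s⁻¹· x R)) → FullyCommutativeᴿ R
  fullyCommutativeᴿ-intro inj far fc-below [] [] _ _ = ε
  fullyCommutativeᴿ-intro inj far fc-below [] (y ∷ u′) red red′ =
    ⊥-elim (0≢1+n (trans (reducedᴿ⇒length≡ℓ inj red) (sym (reducedᴿ⇒length≡ℓ inj red′))))
  fullyCommutativeᴿ-intro inj far fc-below (x ∷ u) [] red red′ =
    ⊥-elim (0≢1+n (trans (reducedᴿ⇒length≡ℓ inj red′) (sym (reducedᴿ⇒length≡ℓ inj red))))
  fullyCommutativeᴿ-intro {R} inj far fc-below (x ∷ u) (y ∷ u′) red red′
    with reducedᴿ-uncons inj red | reducedᴿ-uncons inj red′ | x Fin.≟ y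
  ... | dx , red-u | dy , red-u′ | yes refl = star-cons x (fc-below x dx u u′ red-u red-u′)
  ... | dx , red-u | dy , red-u′ | no x≢y
    with reducedᴿ-exists (s⁻¹· y (s⁻¹· x R))
           (act-columnInjective predₘ y (act-columnInjective predₘ x inj))
  ... | w , red-w =
    star-cons x (fc-below x dx u (y ∷ w) red-u red-yw)
      ◅◅ swap [] w x y x≁y ◅ ε
      ◅◅ star-cons y (fc-below y dy (x ∷ w) u′ red-xw red-u′)
    where
    x≁y : Far x y
    x≁y = far x y dx dy x≢y
    red-yw : Reducedᴿ (s⁻¹· x R) (y ∷ w)
    red-yw = reducedᴿ-cons (act-columnInjective predₘ x inj)
      (descent-act-far predₘ y x R (far-sym x≁y) dy) red-w
    red-xw : Reducedᴿ (s⁻¹· y R) (x ∷ w)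
    red-xw = reducedᴿ-cons (act-columnInjective predₘ y inj) (descent-act-far predₘ x y R x≁y dx)
      (reducedᴿ-cong (≗-sym (act-comm predₘ x y R x≁y)) red-w)

-- The projection π

πᴿ : ∀ {k n m} → Rows k n m → Rows k n 2
πᴿ R i = column (R i) , sign (exponent (R i))

descent-πᴿ : ∀ {k n m} (x : Fin k) (R : Rows k n m) → Descent x (πᴿ R) ≡ Descent x R
descent-πᴿ {suc k} zero    R = cong (_≡ true) (nontrivial-sign (exponent (R zero)))
descent-πᴿ {suc k} (suc p) R =
  cong₂ (λ a b → pairLength (toℕ (column (R (inject₁ p)))) (toℕ (column (R (suc p)))) a
               ≡ suc (pairLength (toℕ (column (R (suc p)))) (toℕ (column (R (inject₁ p)))) b))
    (nontrivial-sign (exponent (R (suc p)))) (nontrivial-sign (exponent (R (inject₁ p))))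

-- The second case is x = 0 with top exponent at least 2, which s₀⁻¹ keeps nontrivial.
πᴿ-s⁻¹· : ∀ {k n m} (x : Fin k) (R : Rows k n m) → Descent x R →
  πᴿ (s⁻¹· x R) ≗ s⁻¹· x (πᴿ R) ⊎ πᴿ (s⁻¹· x R) ≗ πᴿ R
πᴿ-s⁻¹· {suc k} zero R d with sign-predₘ (exponent (R zero)) d
... | inj₁ e = inj₁ λ { zero → cong (column (R zero) ,_) e ; (suc i) → refl }
... | inj₂ e = inj₂ λ { zero → cong (column (R zero) ,_) e ; (suc i) → refl }
πᴿ-s⁻¹· {suc k} (suc p) R _ = inj₁ λ _ → refl

module _ {n m : ℕ} .{{_ : NonZero m}} where

  fullyCommutativeᴿ-πᴿ-step : ∀ {R : Rows n n m} → ColumnInjective R →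
    (∀ x → Descent x R → FullyCommutativeᴿ (s⁻¹· x R) ⇔ FullyCommutativeᴿ (πᴿ (s⁻¹· x R))) →
    FullyCommutativeᴿ R ⇔ FullyCommutativeᴿ (πᴿ R)
  fullyCommutativeᴿ-πᴿ-step {R} inj below = mk⇔ to from
    where
    descent-from-π : ∀ {x} → Descent x (πᴿ R) → Descent x R
    descent-from-π {x} = subst (λ A → A) (descent-πᴿ x R)
    descent-to-π : ∀ {x} → Descent x R → Descent x (πᴿ R)
    descent-to-π {x} = subst (λ A → A) (sym (descent-πᴿ x R))

    to : FullyCommutativeᴿ R → FullyCommutativeᴿ (πᴿ R)
    to fc = fullyCommutativeᴿ-intro inj
      (λ x y dx dy → fullyCommutativeᴿ⇒descentsFar inj fc x y (descent-from-π dx) (descent-from-π dy))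
      fc-below
      where
      fc-below : ∀ x → Descent x (πᴿ R) → FullyCommutativeᴿ (s⁻¹· x (πᴿ R))
      fc-below x dπ = [ (λ e → fullyCommutativeᴿ-cong e fc-π-below)
                      , (λ e → fullyCommutativeᴿ-s⁻¹· inj (fullyCommutativeᴿ-cong e fc-π-below) x dπ)
                      ]′ (πᴿ-s⁻¹· x R d)
        where
        d = descent-from-π dπ
        fc-π-below = Equivalence.to (below x d) (fullyCommutativeᴿ-s⁻¹· inj fc x d)

    from : FullyCommutativeᴿ (πᴿ R) → FullyCommutativeᴿ R
    from fcπ = fullyCommutativeᴿ-intro inj
      (λ x y dx dy → fullyCommutativeᴿ⇒descentsFar inj fcπ x y (descent-to-π dx) (descent-to-π dy))
      fc-below
      where
      fc-below : ∀ x → Descent x R → FullyCommutativeᴿ (s⁻¹· x R)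
      fc-below x d = Equivalence.from (below x d)
        ([ (λ e → fullyCommutativeᴿ-cong (≗-sym e) (fullyCommutativeᴿ-s⁻¹· inj fcπ x (descent-to-π d)))
         , (λ e → fullyCommutativeᴿ-cong (≗-sym e) fcπ)
         ]′ (πᴿ-s⁻¹· x R d))

  fullyCommutativeᴿ⇔πᴿ : ∀ N (R : Rows n n m) → ColumnInjective R → ℓ R ≡ N →
    FullyCommutativeᴿ R ⇔ FullyCommutativeᴿ (πᴿ R)
  fullyCommutativeᴿ⇔πᴿ zero R inj ℓR≡0 = fullyCommutativeᴿ-πᴿ-step inj
    λ x d → ⊥-elim (1+n≢0 (trans (sym (ℓ-descent x R d)) ℓR≡0))
  fullyCommutativeᴿ⇔πᴿ (suc N) R inj ℓR≡1+N = fullyCommutativeᴿ-πᴿ-step inj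
    λ x d → fullyCommutativeᴿ⇔πᴿ N (s⁻¹· x R) (act-columnInjective predₘ x inj)
              (suc-injective (trans (sym (ℓ-descent x R d)) ℓR≡1+N))

transpose-adjacent : ∀ {n} (p : Fin n) i → PC.transpose (suc p) (inject₁ p) i ≡ adjSwap p i
transpose-adjacent p i with i Fin.≟ suc p
... | yes refl = sym (adjSwap-suc p)
... | no i≢p+1 with i Fin.≟ inject₁ p
...   | yes refl = sym (adjSwap-inject₁ p)
...   | no i≢p   = sym (adjSwap-fix p i i≢p i≢p+1)

-- Row r of [w ; a] has its entry ω^(a_c) in column c = w⁻¹(r).
rows : ∀ {m n} → Elem m n → Rows n n m
rows g r = perm g ⟨$⟩ˡ r , exps g (perm g ⟨$⟩ˡ r)

rows-columnInjective : ∀ {m n} (g : Elem m n) → ColumnInjective (rows g)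
rows-columnInjective g i j e =
  trans (sym (inverseʳ (perm g))) (trans (cong (perm g ⟨$⟩ʳ_) e) (inverseʳ (perm g)))

rows-gen : ∀ {m n} .{{_ : NonZero m}} (x : Fin n) (h : Elem m n) → rows (gen x · h) ≗ s· x (rows h)
rows-gen {m} {suc n} zero    h zero    rewrite inverseʳ (perm h) {zero} = refl
rows-gen {m} {suc n} zero    h (suc r) rewrite inverseʳ (perm h) {suc r} =
  cong (perm h ⟨$⟩ˡ suc r ,_) (+ₘ-zero _)
rows-gen {m} {suc n} (suc p) h r       rewrite transpose-adjacent p r =
  cong (perm h ⟨$⟩ˡ adjSwap p r ,_) (+ₘ-zero _)

rows-eval : ∀ {m n} .{{_ : NonZero m}} (w : List (Fin n)) → rows (eval {m} w) ≗ evalᴿ w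
rows-eval []      r = refl
rows-eval (x ∷ w) = ≗-trans (rows-gen x (eval w)) (act-cong sucₘ x (rows-eval w))

≈G⇒rows≗ : ∀ {m n} {g h : Elem m n} → g ≈G h → rows g ≗ rows h
≈G⇒rows≗ {g = g} {h} g≈h r = cong₂ _,_ columns≡ (trans (proj₂ (g≈h c)) (cong (exps h) columns≡))
  where
  c = perm g ⟨$⟩ˡ r
  columns≡ : c ≡ perm h ⟨$⟩ˡ r
  columns≡ = trans (sym (inverseˡ (perm h)))
    (cong (perm h ⟨$⟩ˡ_) (trans (sym (proj₁ (g≈h c))) (inverseʳ (perm g))))

rows≗⇒≈G : ∀ {m n} {g h : Elem m n} → rows g ≗ rows h → g ≈G h
rows≗⇒≈G {g = g} {h} rows≗ i = perm≡ , exps≡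
  where
  r = perm g ⟨$⟩ʳ i
  i≡ : i ≡ perm h ⟨$⟩ˡ r
  i≡ = trans (sym (inverseˡ (perm g))) (cong column (rows≗ r))
  perm≡ : perm g ⟨$⟩ʳ i ≡ perm h ⟨$⟩ʳ i
  perm≡ = sym (trans (cong (perm h ⟨$⟩ʳ_) i≡) (inverseʳ (perm h)))
  exps≡ : exps g i ≡ exps h i
  exps≡ = trans (cong (exps g) (sym (inverseˡ (perm g))))
    (trans (cong exponent (rows≗ r)) (cong (exps h) (sym i≡)))

module _ {m n : ℕ} .{{_ : NonZero m}} (g : Elem m n) where

  reduced⇔reducedᴿ : ∀ w → Reduced g w ⇔ Reducedᴿ (rows g) w
  reduced⇔reducedᴿ w = mk⇔
    (λ (eval≈ , minimal) → reducedᴿ (≗-trans (≗-sym (rows-eval w)) (≈G⇒rows≗ {g = eval w} {h = g} eval≈))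
      λ w′ evalᴿ≗ → minimal w′ (rows≗⇒≈G {g = eval w′} {h = g} (≗-trans (rows-eval w′) evalᴿ≗)))
    (λ (reducedᴿ evalᴿ≗ minimal) → rows≗⇒≈G {g = eval w} {h = g} (≗-trans (rows-eval w) evalᴿ≗)
      , λ w′ eval≈ → minimal w′ (≗-trans (≗-sym (rows-eval w′)) (≈G⇒rows≗ {g = eval w′} {h = g} eval≈)))

  fullyCommutative⇔ᴿ : FullyCommutative g ⇔ FullyCommutativeᴿ (rows g)
  fullyCommutative⇔ᴿ = mk⇔
    (λ fc w w′ red red′ → fc w w′ (from (reduced⇔reducedᴿ w) red) (from (reduced⇔reducedᴿ w′) red′))
    (λ fc w w′ red red′ → fc w w′ (to (reduced⇔reducedᴿ w) red) (to (reduced⇔reducedᴿ w′) red′))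
    where open Equivalence

rows-πB : ∀ {m n} (g : Elem m n) → rows (πB g) ≗ πᴿ (rows g)
rows-πB g r with exps g (perm g ⟨$⟩ˡ r)
... | zero  = refl
... | suc _ = refl

theorem3p3 : (m n : ℕ) → .{{_ : NonZero m}} → .{{_ : NonZero n}} →
    (g : Elem m n) → FullyCommutative g ⇔ FullyCommutative (πB g)
theorem3p3 m n g = begin
  FullyCommutative g               ≈⟨ fullyCommutative⇔ᴿ g ⟩
  FullyCommutativeᴿ (rows g)       ≈⟨ fullyCommutativeᴿ⇔πᴿ (ℓ (rows g)) (rows g) (rows-columnInjective g) refl ⟩
  FullyCommutativeᴿ (πᴿ (rows g))  ≈⟨ mk⇔ (fullyCommutativeᴿ-cong (≗-sym (rows-πB g)))
                                          (fullyCommutativeᴿ-cong (rows-πB g)) ⟩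
  FullyCommutativeᴿ (rows (πB g))  ≈⟨ ⇔-sym (fullyCommutative⇔ᴿ (πB g)) ⟩
  FullyCommutative (πB g)          ∎
  where open SetoidReasoning (⇔-setoid 0ℓ)
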